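{- Let $\Sigma$ be a finite alphabet and let $A \in \Sigma^{m_1\times n_1}$ and $B \in \Sigma^{m_2 \times n_2}$ be nonempty arrays ($m_1,n_1,m_2,n_2 \ge 1$). Consider the following conditions: (a) There exist positive integers $p_1, p_2, q_1, q_2$ such that $A^{p_1 \times q_1} = B^{p_2 \times q_2}$. (b) There exist a nonempty array $C$ and positive integers $r_1, r_2, s_1, s_2$ such that $A = C^{r_1 \times s_1}$ and $B = C^{r_2 \times s_2}$. (c$_h$) There exist positive integers $t_1, t_2, u_1, u_2$ such that $A^{t_1\times u_1}$ and $B^{t_2 \times u_2}$ have the same number of rows and $\mathrm{hcat}(A^{t_1 \times u_1}, B^{t_2 \times u_2}) = \mathrm{hcat}(B^{t_2 \times u_2}, A^{t_1 \times u_1})$. (c$_v$) There exist positive integers $t_1, t_2, u_1, u_2$ such that $A^{t_1\times u_1}$ and $B^{t_2 \times u_2}$ have the same number of columns and $\mathrm{vcat}(A^{t_1 \times u_1}, B^{t_2 \times u_2}) = \mathrm{vcat}(B^{t_2 \times u_2}, A^{t_1 \times u_1})$. Then (a), (b), (c$_h$) and (c$_v$) are equivalent.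
   Context: $\Sigma^{m\times n}$ denotes the set of $m\times n$ rectangular arrays with entries in $\Sigma$, indexed from $0$, so $A[i,j]$ with $0\le i<m$, $0\le j<n$. For $A\in\Sigma^{m\times n}$ and positive integers $p,q$, $A^{p\times q}$ is the $pm \times qn$ array $B$ with $B[i,j] = A[i \bmod m, j \bmod n]$ (i.e. $A$ repeated in $p$ rows and $q$ columns). If $A$ is $m\times n_1$ and $B$ is $m \times n_2$, $\mathrm{hcat}(A,B)$ is the $m\times(n_1+n_2)$ array obtained by placing $B$ to the right of $A$. If $A$ is $m_1\times n$ and $B$ is $m_2\times n$, $\mathrm{vcat}(A,B)$ is the $(m_1+m_2)\times n$ array obtained by placing $B$ underneath $A$. -}

module Defs where

open import Data.Nat using (ℕ; _*_; _+_; NonZero)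
open import Data.Nat.DivMod using (_%_)
open import Data.Fin using (Fin; toℕ; fromℕ<; splitAt)
open import Data.Fin.Properties using ()
open import Data.Nat.DivMod using (m%n<n)
open import Data.Product using (_×_)
open import Data.Sum using (inj₁; inj₂)
open import Relation.Binary.PropositionalEquality using (_≡_)

Array : Set → ℕ → ℕ → Set
Array Σ m n = Fin m → Fin n → Σ

modFin : (m : ℕ) → .{{_ : NonZero m}} → ℕ → Fin m
modFin m i = fromℕ< (m%n<n i m)

rep : {Σ : Set} {m n : ℕ} .{{_ : NonZero m}} .{{_ : NonZero n}} →
      Array Σ m n → (p q : ℕ) → Array Σ (p * m) (q * n)
rep {m = m} {n} A p q i j = A (modFin m (toℕ i)) (modFin n (toℕ j))

hcat : {Σ : Set} {m n₁ n₂ : ℕ} → Array Σ m n₁ → Array Σ m n₂ → Array Σ m (n₁ + n₂)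
hcat {n₁ = n₁} A B i j with splitAt n₁ j
... | inj₁ j₁ = A i j₁
... | inj₂ j₂ = B i j₂

vcat : {Σ : Set} {m₁ m₂ n : ℕ} → Array Σ m₁ n → Array Σ m₂ n → Array Σ (m₁ + m₂) n
vcat {m₁ = m₁} A B i j with splitAt m₁ i
... | inj₁ i₁ = A i₁ j
... | inj₂ i₂ = B i₂ j

-- Equality of arrays whose sizes are not syntactically identical:
-- same dimensions and equal entries at equal positions.
_≅_ : {Σ : Set} {m₁ n₁ m₂ n₂ : ℕ} → Array Σ m₁ n₁ → Array Σ m₂ n₂ → Set
_≅_ {m₁ = m₁} {n₁} {m₂} {n₂} A B =
  (m₁ ≡ m₂) × (n₁ ≡ n₂) ×
  (∀ i i' j j' → toℕ i ≡ toℕ i' → toℕ j ≡ toℕ j' → A i j ≡ B i' j')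

module Submission where

-- Every nonempty m × n array A determines its doubly periodic extension
-- 'extend A : ℕ → ℕ → Σ', (I , J) ↦ A[I mod m , J mod n].  The proof shows
-- that each of the four conditions (a), (b), (c_h), (c_v) is equivalent to
--
--     (E)   extend A = extend B   (pointwise on ℕ × ℕ; 'SameExtension').

open import Defs
open import Data.Nat using (ℕ; NonZero; _*_; _+_; _∸_; _<_; _≤_; _<?_; ≢-nonZero; ≢-nonZero⁻¹; >-nonZero⁻¹)
open import Data.Nat.Properties
open import Algebra.Properties.CommutativeSemigroup +-commutativeSemigroup using (xy∙z≈xz∙y)
open import Data.Nat.DivMod using (_%_; _/_; m%n<n; m≡m%n+[m/n]*n; [m+n]%n≡m%n; m<n⇒m%n≡m)
open import Data.Nat.Divisibility using (_∣_; quotient≢0)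
open _∣_ using (quotient; equality)
open import Data.Nat.GCD using (gcd; gcd-GCD; gcd[m,n]≢0; gcd[m,n]∣m; gcd[m,n]∣n; module Bézout)
open import Data.Nat.Induction using (<-rec)
open import Data.Fin using (Fin; toℕ; fromℕ<; splitAt)
open import Data.Fin.Properties using (toℕ-fromℕ<; toℕ-injective; toℕ-↑ˡ; toℕ-↑ʳ; splitAt⁻¹-↑ˡ; splitAt⁻¹-↑ʳ; toℕ<n)
open import Data.Product using (Σ-syntax; _×_; _,_)
open import Data.Sum using (inj₁; inj₂)
open import Function using (_∘_; flip)
open import Function.Bundles using (_↔_; _⇔_; mk⇔)
open import Relation.Binary.PropositionalEquality
open import Relation.Nullary using (yes; no; contradiction)
open ≡-Reasoning

-- gcd m n ≠ 0 when m ≠ 0 (the tile of condition (b) has gcd dimensions).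
gcd-nonZero : ∀ m n .{{_ : NonZero m}} → NonZero (gcd m n)
gcd-nonZero m n = ≢-nonZero (gcd[m,n]≢0 m n (inj₁ (≢-nonZero⁻¹ m)))

-- A relevant witness of NonZero n from an irrelevant one (the conditions of
-- the theorem store such witnesses).
recompute-nonZero : ∀ n → .{{NonZero n}} → NonZero n
recompute-nonZero n = ≢-nonZero (≢-nonZero⁻¹ n)

Periodic : {S : Set} → (ℕ → S) → ℕ → Set
Periodic f p = ∀ i → f (i + p) ≡ f i

module _ {S : Set} where

  periodic-multiple : ∀ {f : ℕ → S} {p} → Periodic f p → ∀ k → Periodic f (k * p)
  periodic-multiple {f} f-p 0 i = cong f (+-identityʳ i)
  periodic-multiple {f} {p} f-p (ℕ.suc k) i = begin
    f (i + (p + k * p)) ≡⟨ cong f (+-assoc i p (k * p)) ⟨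
    f (i + p + k * p)   ≡⟨ periodic-multiple f-p k (i + p) ⟩
    f (i + p)           ≡⟨ f-p i ⟩
    f i                 ∎

  periodic-mod : ∀ {f : ℕ → S} {p} .{{_ : NonZero p}} → Periodic f p → ∀ i → f i ≡ f (i % p)
  periodic-mod {f} {p} f-p i = begin
    f i                       ≡⟨ cong f (m≡m%n+[m/n]*n i p) ⟩
    f (i % p + (i / p) * p)   ≡⟨ periodic-multiple f-p (i / p) (i % p) ⟩
    f (i % p)                 ∎

  periodic-agree : ∀ {f : ℕ → S} {p} .{{_ : NonZero p}} {g : ℕ → S} → Periodic f p → Periodic g p →
                   (∀ j → j < p → f j ≡ g j) → ∀ j → f j ≡ g j
  periodic-agree {f} {p} {g} f-p g-p agree j = begin
    f j       ≡⟨ periodic-mod f-p j ⟩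
    f (j % p) ≡⟨ agree (j % p) (m%n<n j p) ⟩
    g (j % p) ≡⟨ periodic-mod g-p j ⟨
    g j       ∎

  periodic-bezout : ∀ {f : ℕ → S} {p q d} → Periodic f p → Periodic f q → Bézout.Identity d p q → Periodic f d
  periodic-bezout {f} {p} {q} {d} f-p f-q (Bézout.+- x y eq) i = begin
    f (i + d)             ≡⟨ periodic-multiple f-q y (i + d) ⟨
    f (i + d + y * q)     ≡⟨ cong f (trans (+-assoc i d (y * q)) (cong (i +_) eq)) ⟩
    f (i + x * p)         ≡⟨ periodic-multiple f-p x i ⟩
    f i                   ∎
  periodic-bezout {f} {p} {q} {d} f-p f-q (Bézout.-+ x y eq) i = begin
    f (i + d)             ≡⟨ periodic-multiple f-p x (i + d) ⟨
    f (i + d + x * p)     ≡⟨ cong f (trans (+-assoc i d (x * p)) (cong (i +_) eq)) ⟩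
    f (i + y * q)         ≡⟨ periodic-multiple f-q y i ⟩
    f i                   ∎

  periodic-gcd : ∀ {f : ℕ → S} {p q} → Periodic f p → Periodic f q → Periodic f (gcd p q)
  periodic-gcd {f} {p} {q} f-p f-q = periodic-bezout f-p f-q (Bézout.identity (gcd-GCD p q))

cat : {S : Set} → ℕ → (ℕ → S) → (ℕ → S) → ℕ → S
cat a x y j with j <? a
... | yes _ = x j
... | no _  = y (j ∸ a)

module _ {S : Set} {a : ℕ} {x y : ℕ → S} where

  cat-< : ∀ {j} → j < a → cat a x y j ≡ x j
  cat-< {j} j<a with j <? a
  ... | yes _  = refl
  ... | no j≮a = contradiction j<a j≮a

  cat-≥ : ∀ {j} → a ≤ j → cat a x y j ≡ y (j ∸ a)
  cat-≥ {j} a≤j with j <? a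
  ... | yes j<a = contradiction a≤j (<⇒≱ j<a)
  ... | no _    = refl

  cat-+ : ∀ j → cat a x y (a + j) ≡ y j
  cat-+ j = trans (cat-≥ (m≤m+n a j)) (cong y (m+n∸m≡n a j))

  cat-absorb : (∀ j → y j ≡ x j) → Periodic x a → ∀ j → cat a x y j ≡ x j
  cat-absorb y≡x x-a j with j <? a
  ... | yes _  = refl
  ... | no j≮a = begin
    y (j ∸ a)     ≡⟨ y≡x (j ∸ a) ⟩
    x (j ∸ a)     ≡⟨ x-a (j ∸ a) ⟨
    x (j ∸ a + a) ≡⟨ cong x (m∸n+n≡m (≮⇒≥ j≮a)) ⟩
    x j           ∎

module _ {S : Set} where

  periodic-words-commute : ∀ {a b} {x y : ℕ → S} → (∀ j → x j ≡ y j) →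
    Periodic x a → Periodic y b → ∀ j → cat a x y j ≡ cat b y x j
  periodic-words-commute {a} {b} {x} {y} x≡y x-a y-b j = begin
    cat a x y j ≡⟨ cat-absorb (sym ∘ x≡y) x-a j ⟩
    x j         ≡⟨ x≡y j ⟩
    y j         ≡⟨ cat-absorb x≡y y-b j ⟨
    cat b y x j ∎

  periodic-shift : ∀ {a b} .{{_ : NonZero a}} {w : ℕ → S} → Periodic w a →
    (∀ j → j < a → w (j + b) ≡ w j) → Periodic w b
  periodic-shift {a} {b} {w} w-a shift = periodic-agree shifted-a w-a shift
    where
    shifted-a : Periodic (λ j → w (j + b)) a
    shifted-a j = trans (cong w (xy∙z≈xz∙y j a b)) (w-a (j + b))

  -- Lyndon–Schützenberger: if x[0, a)·y[0, b) = y[0, b)·x[0, a) (compared on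
  -- the common length a + b), then x[0, a) and y[0, b) generate the same
  -- periodic word.  w is the a-periodic word generated by x; one shows by
  -- strong induction that y agrees with w on [0, b), and then that w is
  -- b-periodic.
  commuting-words : (x y : ℕ → S) (a b : ℕ) .{{_ : NonZero a}} .{{_ : NonZero b}} →
    (∀ j → j < a + b → cat a x y j ≡ cat b y x j) → ∀ j → x (j % a) ≡ y (j % b)
  commuting-words x y a b xy≡yx j = begin
    w j       ≡⟨ periodic-mod w-b j ⟩
    w (j % b) ≡⟨ y-prefix (j % b) (m%n<n j b) ⟨
    y (j % b) ∎
    where
    w : ℕ → S
    w j = x (j % a)

    w-a : Periodic w a
    w-a j = cong x ([m+n]%n≡m%n j a)

    x-prefix : ∀ {j} → j < a → x j ≡ w j
    x-prefix j<a = cong x (sym (m<n⇒m%n≡m j<a))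

    y-in-xy : ∀ j → j < b → y j ≡ cat a x y j
    y-in-xy j j<b = begin
      y j         ≡⟨ cat-< j<b ⟨
      cat b y x j ≡⟨ xy≡yx j (<-≤-trans j<b (m≤n+m b a)) ⟨
      cat a x y j ∎

    y-prefix : ∀ j → j < b → y j ≡ w j
    y-prefix = <-rec (λ j → j < b → y j ≡ w j) step
      where
      step : ∀ j → (∀ {k} → k < j → k < b → y k ≡ w k) → j < b → y j ≡ w j
      step j rec j<b with <-≤-connex j a
      ... | inj₁ j<a = trans (y-in-xy j j<b) (trans (cat-< j<a) (x-prefix j<a))
      ... | inj₂ a≤j = begin
        y j           ≡⟨ y-in-xy j j<b ⟩
        cat a x y j   ≡⟨ cat-≥ a≤j ⟩
        y (j ∸ a)     ≡⟨ rec (∸-monoʳ-< (>-nonZero⁻¹ a) a≤j) (≤-<-trans (m∸n≤m j a) j<b) ⟩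
        w (j ∸ a)     ≡⟨ w-a (j ∸ a) ⟨
        w (j ∸ a + a) ≡⟨ cong w (m∸n+n≡m a≤j) ⟩
        w j           ∎

    xy-prefix : ∀ i → i < a + b → cat a x y i ≡ w i
    xy-prefix i i<a+b with <-≤-connex i a
    ... | inj₁ i<a = trans (cat-< i<a) (x-prefix i<a)
    ... | inj₂ a≤i = begin
      cat a x y i   ≡⟨ cat-≥ a≤i ⟩
      y (i ∸ a)     ≡⟨ y-prefix (i ∸ a) (m<n+o⇒m∸n<o i a i<a+b) ⟩
      w (i ∸ a)     ≡⟨ w-a (i ∸ a) ⟨
      w (i ∸ a + a) ≡⟨ cong w (m∸n+n≡m a≤i) ⟩
      w i           ∎

    w-b : Periodic w b
    w-b = periodic-shift w-a λ j j<a → begin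
      w (j + b)         ≡⟨ xy-prefix (j + b) (+-monoˡ-< b j<a) ⟨
      cat a x y (j + b) ≡⟨ xy≡yx (j + b) (+-monoˡ-< b j<a) ⟩
      cat b y x (j + b) ≡⟨ cong (cat b y x) (+-comm j b) ⟩
      cat b y x (b + j) ≡⟨ cat-+ {a = b} {y} {x} j ⟩
      x j               ≡⟨ x-prefix j<a ⟩
      w j               ∎

record Biperiodic {S : Set} (F : ℕ → ℕ → S) (M N : ℕ) : Set where
  constructor biperiodic
  field
    rows : ∀ J → Periodic (λ I → F I J) M
    cols : ∀ I → Periodic (F I) N
open Biperiodic

module _ {S : Set} {F : ℕ → ℕ → S} where

  biperiodic-multiple : ∀ {M N} → Biperiodic F M N → ∀ k l → Biperiodic F (k * M) (l * N)
  biperiodic-multiple F-MN k l =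
    biperiodic (λ J → periodic-multiple (rows F-MN J) k) (λ I → periodic-multiple (cols F-MN I) l)

  biperiodic-gcd : ∀ {M N M′ N′} → Biperiodic F M N → Biperiodic F M′ N′ →
                   Biperiodic F (gcd M M′) (gcd N N′)
  biperiodic-gcd F-MN F-MN′ =
    biperiodic (λ J → periodic-gcd (rows F-MN J) (rows F-MN′ J))
               (λ I → periodic-gcd (cols F-MN I) (cols F-MN′ I))

  biperiodic-flip : ∀ {M N} → Biperiodic F M N → Biperiodic (flip F) N M
  biperiodic-flip F-MN = biperiodic (cols F-MN) (rows F-MN)

  biperiodic-cong : ∀ {G M N} → (∀ I J → F I J ≡ G I J) → Biperiodic F M N → Biperiodic G M N
  biperiodic-cong {G} F≡G F-MN = biperiodic
    (λ J I → trans (sym (F≡G (I + _) J)) (trans (rows F-MN J I) (F≡G I J)))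
    (λ I J → trans (sym (F≡G I (J + _))) (trans (cols F-MN I J) (F≡G I J)))

  biperiodic-mod : ∀ {M N} .{{_ : NonZero M}} .{{_ : NonZero N}} → Biperiodic F M N →
                   ∀ I J → F I J ≡ F (I % M) (J % N)
  biperiodic-mod {M} F-MN I J =
    trans (periodic-mod (rows F-MN J) I) (periodic-mod (cols F-MN (I % M)) J)

  biperiodic-agree : ∀ {G M N} .{{_ : NonZero M}} .{{_ : NonZero N}} →
    Biperiodic F M N → Biperiodic G M N →
    (∀ I J → I < M → J < N → F I J ≡ G I J) → ∀ I J → F I J ≡ G I J
  biperiodic-agree F-MN G-MN agree I J =
    periodic-agree (rows F-MN J) (rows G-MN J)
      (λ I I<M → periodic-agree (cols F-MN I) (cols G-MN I) (λ J J<N → agree I J I<M J<N) J) I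

  commuting-rows : ∀ {G M N₁ N₂} .{{_ : NonZero M}} .{{_ : NonZero N₁}} .{{_ : NonZero N₂}} →
    Biperiodic F M N₁ → Biperiodic G M N₂ →
    (∀ I J → I < M → J < N₁ + N₂ → cat N₁ (F I) (G I) J ≡ cat N₂ (G I) (F I) J) →
    ∀ I J → F I J ≡ G I J
  commuting-rows {G} {M} {N₁} {N₂} F-MN₁ G-MN₂ commute I J =
    periodic-agree (rows F-MN₁ J) (rows G-MN₂ J) (λ I I<M → equal-row I I<M J) I
    where
    equal-row : ∀ I → I < M → ∀ J → F I J ≡ G I J
    equal-row I I<M J = begin
      F I J        ≡⟨ periodic-mod (cols F-MN₁ I) J ⟩
      F I (J % N₁) ≡⟨ commuting-words (F I) (G I) N₁ N₂ (λ J → commute I J I<M) J ⟩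
      G I (J % N₂) ≡⟨ periodic-mod (cols G-MN₂ I) J ⟨
      G I J        ∎

toℕ-modFin : ∀ m .{{_ : NonZero m}} i → toℕ (modFin m i) ≡ i % m
toℕ-modFin m i = toℕ-fromℕ< (m%n<n i m)

modFin-periodic : ∀ m .{{_ : NonZero m}} i → modFin m (i + m) ≡ modFin m i
modFin-periodic m i = toℕ-injective (begin
  toℕ (modFin m (i + m)) ≡⟨ toℕ-modFin m (i + m) ⟩
  (i + m) % m            ≡⟨ [m+n]%n≡m%n i m ⟩
  i % m                  ≡⟨ toℕ-modFin m i ⟨
  toℕ (modFin m i)       ∎)

modFin-toℕ : ∀ {m} .{{_ : NonZero m}} (i : Fin m) → modFin m (toℕ i) ≡ i
modFin-toℕ {m} i = toℕ-injective (trans (toℕ-modFin m (toℕ i)) (m<n⇒m%n≡m (toℕ<n i)))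

module _ {S : Set} where

  extend : ∀ {m n} .{{_ : NonZero m}} .{{_ : NonZero n}} → Array S m n → ℕ → ℕ → S
  extend {m} {n} A I J = A (modFin m I) (modFin n J)

  window : (ℕ → ℕ → S) → (M N : ℕ) → Array S M N
  window F M N i j = F (toℕ i) (toℕ j)

  module _ {m n : ℕ} .{{_ : NonZero m}} .{{_ : NonZero n}} where

    extend-biperiodic : (A : Array S m n) → Biperiodic (extend A) m n
    extend-biperiodic A = biperiodic
      (λ J I → cong (λ i → A i (modFin n J)) (modFin-periodic m I))
      (λ I J → cong (A (modFin m I)) (modFin-periodic n J))

    extend-toℕ : (A : Array S m n) → ∀ i j → extend A (toℕ i) (toℕ j) ≡ A i j
    extend-toℕ A i j = cong₂ A (modFin-toℕ i) (modFin-toℕ j)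

    extend-window : ∀ {F} → Biperiodic F m n → ∀ I J → extend (window F m n) I J ≡ F I J
    extend-window {F} F-mn I J =
      trans (cong₂ F (toℕ-modFin m I) (toℕ-modFin n J)) (sym (biperiodic-mod F-mn I J))

  _represents_ : ∀ {m n} → Array S m n → (ℕ → ℕ → S) → Set
  X represents F = ∀ i j → X i j ≡ F (toℕ i) (toℕ j)

  array-represents : ∀ {m n} .{{_ : NonZero m}} .{{_ : NonZero n}} (A : Array S m n) →
                     A represents extend A
  array-represents A i j = sym (extend-toℕ A i j)

  rep-represents : ∀ {m n} .{{_ : NonZero m}} .{{_ : NonZero n}} (A : Array S m n) (p q : ℕ) →
                   rep A p q represents extend A
  rep-represents A p q i j = refl

  subst-rows-represents : ∀ {r r′ c} {X : Array S r c} {F} (e : r ≡ r′) →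
    X represents F → subst (λ r → Array S r c) e X represents F
  subst-rows-represents refl X⊨F = X⊨F

  subst-cols-represents : ∀ {r c c′} {X : Array S r c} {F} (e : c ≡ c′) →
    X represents F → subst (λ c → Array S r c) e X represents F
  subst-cols-represents refl X⊨F = X⊨F

  toℕ-splitAtˡ : ∀ n₁ {n₂} {j : Fin (n₁ + n₂)} {k} → splitAt n₁ j ≡ inj₁ k → toℕ j ≡ toℕ k
  toℕ-splitAtˡ n₁ {n₂} {k = k} eq = trans (cong toℕ (sym (splitAt⁻¹-↑ˡ eq))) (toℕ-↑ˡ k n₂)

  toℕ-splitAtʳ : ∀ n₁ {n₂} {j : Fin (n₁ + n₂)} {k} → splitAt n₁ j ≡ inj₂ k → toℕ j ≡ n₁ + toℕ k
  toℕ-splitAtʳ n₁ {k = k} eq = trans (cong toℕ (sym (splitAt⁻¹-↑ʳ eq))) (toℕ-↑ʳ n₁ k)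

  hcat-represents : ∀ {m n₁ n₂} {X : Array S m n₁} {Y : Array S m n₂} {F G} →
    X represents F → Y represents G → hcat X Y represents (λ I → cat n₁ (F I) (G I))
  hcat-represents {n₁ = n₁} {X = X} {Y} {F} {G} X⊨F Y⊨G i j with splitAt n₁ j in eq
  ... | inj₁ k = begin
    X i k                       ≡⟨ X⊨F i k ⟩
    F (toℕ i) (toℕ k)           ≡⟨ cat-< {x = F (toℕ i)} {y = G (toℕ i)} (toℕ<n k) ⟨
    cat n₁ (F _) (G _) (toℕ k)  ≡⟨ cong (cat n₁ (F _) (G _)) (toℕ-splitAtˡ n₁ eq) ⟨
    cat n₁ (F _) (G _) (toℕ j)  ∎
  ... | inj₂ k = begin
    Y i k                           ≡⟨ Y⊨G i k ⟩
    G (toℕ i) (toℕ k)               ≡⟨ cat-+ {a = n₁} {x = F (toℕ i)} {y = G (toℕ i)} (toℕ k) ⟨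
    cat n₁ (F _) (G _) (n₁ + toℕ k) ≡⟨ cong (cat n₁ (F _) (G _)) (toℕ-splitAtʳ n₁ eq) ⟨
    cat n₁ (F _) (G _) (toℕ j)      ∎

  vcat-transpose : ∀ {m₁ m₂ n} (X : Array S m₁ n) (Y : Array S m₂ n) →
    ∀ i j → vcat X Y i j ≡ hcat (flip X) (flip Y) j i
  vcat-transpose {m₁} X Y i j with splitAt m₁ i
  ... | inj₁ _ = refl
  ... | inj₂ _ = refl

  vcat-represents : ∀ {m₁ m₂ n} {X : Array S m₁ n} {Y : Array S m₂ n} {F G} →
    X represents F → Y represents G →
    vcat X Y represents (λ I J → cat m₁ (λ I → F I J) (λ I → G I J) I)
  vcat-represents {X = X} {Y} {F} {G} X⊨F Y⊨G i j =
    trans (vcat-transpose X Y i j)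
          (hcat-represents {F = flip F} {flip G} (λ j i → X⊨F i j) (λ j i → Y⊨G i j) j i)

  ≅-sound : ∀ {m₁ n₁ m₂ n₂} {X : Array S m₁ n₁} {Y : Array S m₂ n₂} {F G} →
    X ≅ Y → X represents F → Y represents G → ∀ I J → I < m₁ → J < n₁ → F I J ≡ G I J
  ≅-sound {X = X} {Y} {F} {G} (m₁≡m₂ , n₁≡n₂ , X≅Y) X⊨F Y⊨G I J I<m₁ J<n₁ = begin
    F I J               ≡⟨ cong₂ F (toℕ-fromℕ< I<m₁) (toℕ-fromℕ< J<n₁) ⟨
    F (toℕ i) (toℕ j)   ≡⟨ X⊨F i j ⟨
    X i j               ≡⟨ X≅Y i i′ j j′ (trans (toℕ-fromℕ< _) (sym (toℕ-fromℕ< _)))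
                                         (trans (toℕ-fromℕ< _) (sym (toℕ-fromℕ< _))) ⟩
    Y i′ j′             ≡⟨ Y⊨G i′ j′ ⟩
    G (toℕ i′) (toℕ j′) ≡⟨ cong₂ G (toℕ-fromℕ< _) (toℕ-fromℕ< _) ⟩
    G I J               ∎
    where
    i = fromℕ< I<m₁
    j = fromℕ< J<n₁
    i′ = fromℕ< (subst (I <_) m₁≡m₂ I<m₁)
    j′ = fromℕ< (subst (J <_) n₁≡n₂ J<n₁)

  ≅-complete : ∀ {m₁ n₁ m₂ n₂} {X : Array S m₁ n₁} {Y : Array S m₂ n₂} {F G} →
    m₁ ≡ m₂ → n₁ ≡ n₂ → X represents F → Y represents G → (∀ I J → F I J ≡ G I J) → X ≅ Y
  ≅-complete {F = F} {G} m₁≡m₂ n₁≡n₂ X⊨F Y⊨G F≡G = m₁≡m₂ , n₁≡n₂ , λ i i′ j j′ i≡i′ j≡j′ →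
    trans (X⊨F i j) (trans (F≡G _ _) (trans (cong₂ G i≡i′ j≡j′) (sym (Y⊨G i′ j′))))

  ≅-biperiodic : ∀ {m₁ n₁ m₂ n₂} .{{_ : NonZero m₁}} .{{_ : NonZero n₁}}
    {X : Array S m₁ n₁} {Y : Array S m₂ n₂} {F G} →
    X ≅ Y → X represents F → Y represents G →
    Biperiodic F m₁ n₁ → Biperiodic G m₂ n₂ → ∀ I J → F I J ≡ G I J
  ≅-biperiodic {G = G} X≅Y@(m₁≡m₂ , n₁≡n₂ , _) X⊨F Y⊨G F-per G-per =
    biperiodic-agree F-per (subst₂ (Biperiodic G) (sym m₁≡m₂) (sym n₁≡n₂) G-per) (≅-sound X≅Y X⊨F Y⊨G)

  tiling-extension : ∀ {M N m n} .{{_ : NonZero M}} .{{_ : NonZero N}}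
    .{{_ : NonZero m}} .{{_ : NonZero n}} (X : Array S M N) (C : Array S m n) (r s : ℕ) →
    X ≅ rep C r s → ∀ I J → extend X I J ≡ extend C I J
  tiling-extension X C r s X≅C =
    ≅-biperiodic X≅C (array-represents X) (rep-represents C r s)
      (extend-biperiodic X) (biperiodic-multiple (extend-biperiodic C) r s)

  window-tiling : ∀ {M N g h} .{{_ : NonZero g}} .{{_ : NonZero h}}
    {X : Array S M N} {F} → X represents F → Biperiodic F g h →
    (g∣M : g ∣ M) (h∣N : h ∣ N) →
    X ≅ rep (window F g h) (quotient g∣M) (quotient h∣N)
  window-tiling {g = g} {h} {F = F} X⊨F F-gh g∣M h∣N =
    ≅-complete (equality g∣M) (equality h∣N) X⊨F
      (rep-represents (window F g h) (quotient g∣M) (quotient h∣N))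
      (λ I J → sym (extend-window F-gh I J))

  hcat-rep-represents : ∀ {m₁ n₁ m₂ n₂} .{{_ : NonZero m₁}} .{{_ : NonZero n₁}}
    .{{_ : NonZero m₂}} .{{_ : NonZero n₂}} (A : Array S m₁ n₁) (B : Array S m₂ n₂)
    (t₁ t₂ u₁ u₂ : ℕ) (e : t₂ * m₂ ≡ t₁ * m₁) →
    hcat (rep A t₁ u₁) (subst (λ r → Array S r (u₂ * n₂)) e (rep B t₂ u₂))
      represents (λ I → cat (u₁ * n₁) (extend A I) (extend B I))
  hcat-rep-represents A B t₁ t₂ u₁ u₂ e =
    hcat-represents {F = extend A} {extend B} (rep-represents A t₁ u₁)
      (subst-rows-represents {F = extend B} e (rep-represents B t₂ u₂))

  vcat-rep-represents : ∀ {m₁ n₁ m₂ n₂} .{{_ : NonZero m₁}} .{{_ : NonZero n₁}}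
    .{{_ : NonZero m₂}} .{{_ : NonZero n₂}} (A : Array S m₁ n₁) (B : Array S m₂ n₂)
    (t₁ t₂ u₁ u₂ : ℕ) (e : u₂ * n₂ ≡ u₁ * n₁) →
    vcat (rep A t₁ u₁) (subst (λ c → Array S (t₂ * m₂) c) e (rep B t₂ u₂))
      represents (λ I J → cat (t₁ * m₁) (λ I → extend A I J) (λ I → extend B I J) I)
  vcat-rep-represents A B t₁ t₂ u₁ u₂ e =
    vcat-represents {F = extend A} {extend B} (rep-represents A t₁ u₁)
      (subst-cols-represents {F = extend B} e (rep-represents B t₂ u₂))

module Equivalences {S : Set} {m₁ n₁ m₂ n₂ : ℕ} .{{_ : NonZero m₁}} .{{_ : NonZero n₁}}
    .{{_ : NonZero m₂}} .{{_ : NonZero n₂}} (A : Array S m₁ n₁) (B : Array S m₂ n₂) where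

  SameExtension : Set
  SameExtension = ∀ I J → extend A I J ≡ extend B I J

  condA : Set
  condA = Σ[ p₁ ∈ ℕ ] Σ[ p₂ ∈ ℕ ] Σ[ q₁ ∈ ℕ ] Σ[ q₂ ∈ ℕ ]
    Σ[ _ ∈ NonZero p₁ ] Σ[ _ ∈ NonZero p₂ ] Σ[ _ ∈ NonZero q₁ ] Σ[ _ ∈ NonZero q₂ ]
      (rep A p₁ q₁ ≅ rep B p₂ q₂)

  condB : Set
  condB = Σ[ m ∈ ℕ ] Σ[ n ∈ ℕ ] Σ[ mnz ∈ NonZero m ] Σ[ nnz ∈ NonZero n ]
    Σ[ C ∈ Array S m n ]
    Σ[ r₁ ∈ ℕ ] Σ[ r₂ ∈ ℕ ] Σ[ s₁ ∈ ℕ ] Σ[ s₂ ∈ ℕ ]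
    Σ[ _ ∈ NonZero r₁ ] Σ[ _ ∈ NonZero r₂ ] Σ[ _ ∈ NonZero s₁ ] Σ[ _ ∈ NonZero s₂ ]
      ((A ≅ rep {{mnz}} {{nnz}} C r₁ s₁) × (B ≅ rep {{mnz}} {{nnz}} C r₂ s₂))

  condCh : Set
  condCh = Σ[ t₁ ∈ ℕ ] Σ[ t₂ ∈ ℕ ] Σ[ u₁ ∈ ℕ ] Σ[ u₂ ∈ ℕ ]
    Σ[ _ ∈ NonZero t₁ ] Σ[ _ ∈ NonZero t₂ ] Σ[ _ ∈ NonZero u₁ ] Σ[ _ ∈ NonZero u₂ ]
    Σ[ e ∈ t₁ * m₁ ≡ t₂ * m₂ ]
      (hcat (rep A t₁ u₁) (subst (λ r → Array S r (u₂ * n₂)) (sym e) (rep B t₂ u₂))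
        ≅ hcat (rep B t₂ u₂) (subst (λ r → Array S r (u₁ * n₁)) e (rep A t₁ u₁)))

  condCv : Set
  condCv = Σ[ t₁ ∈ ℕ ] Σ[ t₂ ∈ ℕ ] Σ[ u₁ ∈ ℕ ] Σ[ u₂ ∈ ℕ ]
    Σ[ _ ∈ NonZero t₁ ] Σ[ _ ∈ NonZero t₂ ] Σ[ _ ∈ NonZero u₁ ] Σ[ _ ∈ NonZero u₂ ]
    Σ[ e ∈ u₁ * n₁ ≡ u₂ * n₂ ]
      (vcat (rep A t₁ u₁) (subst (λ c → Array S (t₂ * m₂) c) (sym e) (rep B t₂ u₂))
        ≅ vcat (rep B t₂ u₂) (subst (λ c → Array S (t₁ * m₁) c) e (rep A t₁ u₁)))

  extend-A : Biperiodic (extend A) m₁ n₁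
  extend-A = extend-biperiodic A

  extend-B : Biperiodic (extend B) m₂ n₂
  extend-B = extend-biperiodic B

  same⇒condA : SameExtension → condA
  same⇒condA same =
    m₂ , m₁ , n₂ , n₁ , recompute-nonZero m₂ , recompute-nonZero m₁ ,
    recompute-nonZero n₂ , recompute-nonZero n₁ ,
    ≅-complete (*-comm m₂ m₁) (*-comm n₂ n₁) (rep-represents A m₂ n₂) (rep-represents B m₁ n₁) same

  -- (a) ⇒ (E): both repetitions are windows of the extensions, with periods.
  condA⇒same : condA → SameExtension
  condA⇒same (p₁ , p₂ , q₁ , q₂ , p₁≢0 , _ , q₁≢0 , _ , A≅B) =
    ≅-biperiodic {{m*n≢0 p₁ m₁ {{p₁≢0}}}} {{m*n≢0 q₁ n₁ {{q₁≢0}}}} A≅B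
      (rep-represents A p₁ q₁) (rep-represents B p₂ q₂)
      (biperiodic-multiple extend-A p₁ q₁) (biperiodic-multiple extend-B p₂ q₂)

  -- (b) ⇒ (E): both extensions equal the extension of the common tile C.
  condB⇒same : condB → SameExtension
  condB⇒same (m , n , m≢0 , n≢0 , C , r₁ , r₂ , s₁ , s₂ , _ , _ , _ , _ , A≅C , B≅C) I J =
    trans (tiling-extension {{_}} {{_}} {{m≢0}} {{n≢0}} A C r₁ s₁ A≅C I J)
          (sym (tiling-extension {{_}} {{_}} {{m≢0}} {{n≢0}} B C r₂ s₂ B≅C I J))

  -- (E) ⇒ (b): the common extension has periods g = gcd(m₁, m₂) and
  -- h = gcd(n₁, n₂), so its g × h window C tiles both A and B.
  same⇒condB : SameExtension → condB
  same⇒condB same =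
    g , h , g≢0 , h≢0 , window (extend A) g h ,
    quotient g∣m₁ , quotient g∣m₂ , quotient h∣n₁ , quotient h∣n₂ ,
    quotient≢0 g∣m₁ , quotient≢0 g∣m₂ , quotient≢0 h∣n₁ , quotient≢0 h∣n₂ ,
    window-tiling {{g≢0}} {{h≢0}} (array-represents A) common-periods g∣m₁ h∣n₁ ,
    window-tiling {{g≢0}} {{h≢0}} B-represents-extend-A common-periods g∣m₂ h∣n₂
    where
    g h : ℕ
    g = gcd m₁ m₂
    h = gcd n₁ n₂

    g≢0 : NonZero g
    g≢0 = gcd-nonZero m₁ m₂

    h≢0 : NonZero h
    h≢0 = gcd-nonZero n₁ n₂

    g∣m₁ : g ∣ m₁
    g∣m₁ = gcd[m,n]∣m m₁ m₂

    g∣m₂ : g ∣ m₂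
    g∣m₂ = gcd[m,n]∣n m₁ m₂

    h∣n₁ : h ∣ n₁
    h∣n₁ = gcd[m,n]∣m n₁ n₂

    h∣n₂ : h ∣ n₂
    h∣n₂ = gcd[m,n]∣n n₁ n₂

    common-periods : Biperiodic (extend A) g h
    common-periods = biperiodic-gcd extend-A (biperiodic-cong (λ I J → sym (same I J)) extend-B)

    B-represents-extend-A : B represents extend A
    B-represents-extend-A i j = trans (array-represents B i j) (sym (same _ _))

  -- (c_h) ⇒ (E): row by row, the commutation hcat(A', B') = hcat(B', A') is
  -- a commutation of words, so 'commuting-rows' applies.
  condCh⇒same : condCh → SameExtension
  condCh⇒same (t₁ , t₂ , u₁ , u₂ , t₁≢0 , _ , u₁≢0 , u₂≢0 , e , AB≅BA) =
    commuting-rows {{m*n≢0 t₁ m₁ {{t₁≢0}}}} {{m*n≢0 u₁ n₁ {{u₁≢0}}}} {{m*n≢0 u₂ n₂ {{u₂≢0}}}}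
      A-periods B-periods
      (≅-sound AB≅BA (hcat-rep-represents A B t₁ t₂ u₁ u₂ (sym e))
                              (hcat-rep-represents B A t₂ t₁ u₂ u₁ e))
    where
    A-periods : Biperiodic (extend A) (t₁ * m₁) (u₁ * n₁)
    A-periods = biperiodic-multiple extend-A t₁ u₁

    B-periods : Biperiodic (extend B) (t₁ * m₁) (u₂ * n₂)
    B-periods = subst (λ M → Biperiodic (extend B) M (u₂ * n₂)) (sym e)
                      (biperiodic-multiple extend-B t₂ u₂)

  -- (E) ⇒ (c_h) with A^{m₂×n₂} and B^{m₁×n₁}: equal periodic words commute.
  same⇒condCh : SameExtension → condCh
  same⇒condCh same =
    m₂ , m₁ , n₂ , n₁ , recompute-nonZero m₂ , recompute-nonZero m₁ ,
    recompute-nonZero n₂ , recompute-nonZero n₁ , *-comm m₂ m₁ ,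
    ≅-complete (*-comm m₂ m₁) (+-comm (n₂ * n₁) (n₁ * n₂))
      (hcat-rep-represents A B m₂ m₁ n₂ n₁ (sym (*-comm m₂ m₁)))
      (hcat-rep-represents B A m₁ m₂ n₁ n₂ (*-comm m₂ m₁))
      (λ I → periodic-words-commute (same I)
               (cols (biperiodic-multiple extend-A m₂ n₂) I)
               (cols (biperiodic-multiple extend-B m₁ n₁) I))

  -- (c_v) ⇒ (E): the same argument on the transposed extensions.
  condCv⇒same : condCv → SameExtension
  condCv⇒same (t₁ , t₂ , u₁ , u₂ , t₁≢0 , t₂≢0 , u₁≢0 , _ , e , AB≅BA) I J =
    commuting-rows {{m*n≢0 u₁ n₁ {{u₁≢0}}}} {{m*n≢0 t₁ m₁ {{t₁≢0}}}} {{m*n≢0 t₂ m₂ {{t₂≢0}}}}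
      (biperiodic-flip A-periods) (biperiodic-flip B-periods)
      (λ J I J<N I<M → ≅-sound AB≅BA (vcat-rep-represents A B t₁ t₂ u₁ u₂ (sym e))
                                     (vcat-rep-represents B A t₂ t₁ u₂ u₁ e) I J I<M J<N)
      J I
    where
    A-periods : Biperiodic (extend A) (t₁ * m₁) (u₁ * n₁)
    A-periods = biperiodic-multiple extend-A t₁ u₁

    B-periods : Biperiodic (extend B) (t₂ * m₂) (u₁ * n₁)
    B-periods = subst (Biperiodic (extend B) (t₂ * m₂)) (sym e)
                      (biperiodic-multiple extend-B t₂ u₂)

  same⇒condCv : SameExtension → condCv
  same⇒condCv same =
    m₂ , m₁ , n₂ , n₁ , recompute-nonZero m₂ , recompute-nonZero m₁ ,
    recompute-nonZero n₂ , recompute-nonZero n₁ , *-comm n₂ n₁ ,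
    ≅-complete (+-comm (m₂ * m₁) (m₁ * m₂)) (*-comm n₂ n₁)
      (vcat-rep-represents A B m₂ m₁ n₂ n₁ (sym (*-comm n₂ n₁)))
      (vcat-rep-represents B A m₁ m₂ n₁ n₂ (*-comm n₂ n₁))
      (λ I J → periodic-words-commute (λ I → same I J)
                 (rows (biperiodic-multiple extend-A m₂ n₂) J)
                 (rows (biperiodic-multiple extend-B m₁ n₁) J) I)

theorem3 : (Σ : Set) (k : ℕ) → Σ ↔ Fin k →
    (m₁ n₁ m₂ n₂ : ℕ) → .{{_ : NonZero m₁}} → .{{_ : NonZero n₁}} →
    .{{_ : NonZero m₂}} → .{{_ : NonZero n₂}} →
    (A : Array Σ m₁ n₁) (B : Array Σ m₂ n₂) →
    let
      condA = Σ[ p₁ ∈ ℕ ] Σ[ p₂ ∈ ℕ ] Σ[ q₁ ∈ ℕ ] Σ[ q₂ ∈ ℕ ]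
        Σ[ _ ∈ NonZero p₁ ] Σ[ _ ∈ NonZero p₂ ] Σ[ _ ∈ NonZero q₁ ] Σ[ _ ∈ NonZero q₂ ]
          (rep A p₁ q₁ ≅ rep B p₂ q₂)
      condB = Σ[ m ∈ ℕ ] Σ[ n ∈ ℕ ] Σ[ mnz ∈ NonZero m ] Σ[ nnz ∈ NonZero n ]
        Σ[ C ∈ Array Σ m n ]
        Σ[ r₁ ∈ ℕ ] Σ[ r₂ ∈ ℕ ] Σ[ s₁ ∈ ℕ ] Σ[ s₂ ∈ ℕ ]
        Σ[ _ ∈ NonZero r₁ ] Σ[ _ ∈ NonZero r₂ ] Σ[ _ ∈ NonZero s₁ ] Σ[ _ ∈ NonZero s₂ ]
          ((A ≅ rep {{mnz}} {{nnz}} C r₁ s₁) × (B ≅ rep {{mnz}} {{nnz}} C r₂ s₂))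
      condCh = Σ[ t₁ ∈ ℕ ] Σ[ t₂ ∈ ℕ ] Σ[ u₁ ∈ ℕ ] Σ[ u₂ ∈ ℕ ]
        Σ[ _ ∈ NonZero t₁ ] Σ[ _ ∈ NonZero t₂ ] Σ[ _ ∈ NonZero u₁ ] Σ[ _ ∈ NonZero u₂ ]
        Σ[ e ∈ t₁ * m₁ ≡ t₂ * m₂ ]
          (hcat (rep A t₁ u₁) (subst (λ r → Array Σ r (u₂ * n₂)) (sym e) (rep B t₂ u₂))
            ≅ hcat (rep B t₂ u₂) (subst (λ r → Array Σ r (u₁ * n₁)) e (rep A t₁ u₁)))
      condCv = Σ[ t₁ ∈ ℕ ] Σ[ t₂ ∈ ℕ ] Σ[ u₁ ∈ ℕ ] Σ[ u₂ ∈ ℕ ]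
        Σ[ _ ∈ NonZero t₁ ] Σ[ _ ∈ NonZero t₂ ] Σ[ _ ∈ NonZero u₁ ] Σ[ _ ∈ NonZero u₂ ]
        Σ[ e ∈ u₁ * n₁ ≡ u₂ * n₂ ]
          (vcat (rep A t₁ u₁) (subst (λ c → Array Σ (t₂ * m₂) c) (sym e) (rep B t₂ u₂))
            ≅ vcat (rep B t₂ u₂) (subst (λ c → Array Σ (t₁ * m₁) c) e (rep A t₁ u₁)))
    in (condA ⇔ condB) × (condA ⇔ condCh) × (condA ⇔ condCv)
theorem3 _ _ _ _ _ _ _ A B =
  mk⇔ (same⇒condB ∘ condA⇒same) (same⇒condA ∘ condB⇒same) ,
  mk⇔ (same⇒condCh ∘ condA⇒same) (same⇒condA ∘ condCh⇒same) ,
  mk⇔ (same⇒condCv ∘ condA⇒same) (same⇒condA ∘ condCv⇒same)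
  where open Equivalences A B
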